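{- Let $\mathcal{L}\in\{\mathtt{M},\mathtt{ME},\mathtt{ME}^\infty\}$ and $B\subseteq A$. Every syntactically $B$-continuous sentence of $\mathcal{L}(A)$ is continuous in $B$.
   Context: Fix a finite set $A$ of monadic predicate symbols. A monadic model is $(D,V)$, $D$ a set (possibly empty), $V:A\to\wp(D)$. $\mathtt{ME}^\infty(A)$: $\varphi::=\top\mid\bot\mid a(x)\mid\neg a(x)\mid x\approx y\mid x\not\approx y\mid\varphi\vee\varphi\mid\varphi\wedge\varphi\mid\exists x.\varphi\mid\forall x.\varphi\mid\exists^\infty x.\varphi\mid\forall^\infty x.\varphi$; $\mathtt{ME}(A)$ omits $\exists^\infty,\forall^\infty$; $\mathtt{M}(A)$ also omits $\approx,\not\approx$. Standard semantics on nonempty models ($\exists^\infty$: infinitely many, $\forall^\infty$: all but finitely many); on the empty model $\exists,\exists^\infty$-sentences false, $\forall,\forall^\infty$-sentences true. $U\le_B V$ iff $U(b)\subseteq V(b)$ ($b\in B$), $U(a)=V(a)$ ($a\notin B$); $U\le^\omega_B V$ iff additionally each $U(b)$, $b\in B$, is finite. $\phi$ monotone in $B$: $(D,V),g\models\phi$ and $V\le_B V'$ imply $(D,V'),g\models\phi$. $\phi$ continuous in $B$: monotone in $B$ and $(D,V),g\models\phi$ implies $(D,U),g\models\phi$ for some $U\le^\omega_B V$. Syntactically $B$-continuous formulas of $\mathcal{L}(A)$ for $\mathcal{L}\in\{\mathtt{M},\mathtt{ME}\}$: $\phi::=\psi\mid b(x)\mid\phi\wedge\phi\mid\phi\vee\phi\mid\exists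 x.\phi$, $b\in B$, $\psi\in\mathcal{L}(A\setminus B)$. With $\mathbf{W}x.(\phi,\psi):=\forall x.(\phi(x)\vee\psi(x))\wedge\forall^\infty x.\psi(x)$, those of $\mathtt{ME}^\infty(A)$: $\phi::=\psi\mid b(x)\mid\phi\wedge\phi\mid\phi\vee\phi\mid\exists x.\phi\mid\mathbf{W}x.(\phi,\psi)$, $b\in B$, $\psi\in\mathtt{ME}^\infty(A\setminus B)$. -}

module Defs where

open import Data.Nat using (ℕ; suc)
open import Data.Fin using (Fin; zero; suc)
open import Data.Fin.Subset using (Subset) renaming (_∈_ to _∈ₛ_; _∉_ to _∉ₛ_)
open import Data.List using (List)
open import Data.List.Membership.Propositional using (_∈_)
open import Data.Product using (Σ; _×_; ∃)
open import Data.Sum using (_⊎_)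
open import Data.Unit using (⊤)
open import Data.Empty using (⊥)
open import Relation.Nullary using (¬_)
open import Relation.Binary.PropositionalEquality using (_≡_)
open import Function.Bundles using (_⇔_)

-- Predicate symbols: A = Fin k.  Formulas with (de Bruijn) free variables in Fin n.
data Fm (k n : ℕ) : Set where
  tt ff    : Fm k n
  atom     : Fin k → Fin n → Fm k n
  natom    : Fin k → Fin n → Fm k n
  eq neq   : Fin n → Fin n → Fm k n
  or and   : Fm k n → Fm k n → Fm k n
  ex all   : Fm k (suc n) → Fm k n
  exInf allInf : Fm k (suc n) → Fm k n

W : ∀ {k n} → Fm k (suc n) → Fm k (suc n) → Fm k n
W φ ψ = and (all (or φ ψ)) (allInf ψ)

data Lang : Set where
  M ME MEinf : Lang

data HasEq : Lang → Set where
  hasEq-ME : HasEq ME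
  hasEq-MEinf : HasEq MEinf

data HasInf : Lang → Set where
  hasInf-MEinf : HasInf MEinf

data InLang (L : Lang) {k : ℕ} : ∀ {n} → Fm k n → Set where
  tt    : ∀ {n} → InLang L (tt {k} {n})
  ff    : ∀ {n} → InLang L (ff {k} {n})
  atom  : ∀ {n} a (x : Fin n) → InLang L (atom a x)
  natom : ∀ {n} a (x : Fin n) → InLang L (natom a x)
  eq    : ∀ {n} (x y : Fin n) → HasEq L → InLang L (eq {k} x y)
  neq   : ∀ {n} (x y : Fin n) → HasEq L → InLang L (neq {k} x y)
  or    : ∀ {n} {φ ψ : Fm k n} → InLang L φ → InLang L ψ → InLang L (or φ ψ)
  and   : ∀ {n} {φ ψ : Fm k n} → InLang L φ → InLang L ψ → InLang L (and φ ψ)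
  ex    : ∀ {n} {φ : Fm k (suc n)} → InLang L φ → InLang L (ex φ)
  all   : ∀ {n} {φ : Fm k (suc n)} → InLang L φ → InLang L (all φ)
  exInf : ∀ {n} {φ : Fm k (suc n)} → HasInf L → InLang L φ → InLang L (exInf φ)
  allInf : ∀ {n} {φ : Fm k (suc n)} → HasInf L → InLang L φ → InLang L (allInf φ)

data Free {k : ℕ} (B : Subset k) : ∀ {n} → Fm k n → Set where
  tt    : ∀ {n} → Free B (tt {k} {n})
  ff    : ∀ {n} → Free B (ff {k} {n})
  atom  : ∀ {n} a (x : Fin n) → a ∉ₛ B → Free B (atom a x)
  natom : ∀ {n} a (x : Fin n) → a ∉ₛ B → Free B (natom a x)
  eq    : ∀ {n} (x y : Fin n) → Free B (eq {k} x y)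
  neq   : ∀ {n} (x y : Fin n) → Free B (neq {k} x y)
  or    : ∀ {n} {φ ψ : Fm k n} → Free B φ → Free B ψ → Free B (or φ ψ)
  and   : ∀ {n} {φ ψ : Fm k n} → Free B φ → Free B ψ → Free B (and φ ψ)
  ex    : ∀ {n} {φ : Fm k (suc n)} → Free B φ → Free B (ex φ)
  all   : ∀ {n} {φ : Fm k (suc n)} → Free B φ → Free B (all φ)
  exInf : ∀ {n} {φ : Fm k (suc n)} → Free B φ → Free B (exInf φ)
  allInf : ∀ {n} {φ : Fm k (suc n)} → Free B φ → Free B (allInf φ)

data SynCont (L : Lang) {k : ℕ} (B : Subset k) : ∀ {n} → Fm k n → Set where
  base : ∀ {n} {ψ : Fm k n} → InLang L ψ → Free B ψ → SynCont L B ψ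
  atomB : ∀ {n} b (x : Fin n) → b ∈ₛ B → SynCont L B (atom b x)
  and  : ∀ {n} {φ φ' : Fm k n} → SynCont L B φ → SynCont L B φ' → SynCont L B (and φ φ')
  or   : ∀ {n} {φ φ' : Fm k n} → SynCont L B φ → SynCont L B φ' → SynCont L B (or φ φ')
  ex   : ∀ {n} {φ : Fm k (suc n)} → SynCont L B φ → SynCont L B (ex φ)
  W'   : ∀ {n} {φ ψ : Fm k (suc n)} → L ≡ MEinf →
         SynCont L B φ → InLang L ψ → Free B ψ → SynCont L B (W φ ψ)

Finite : {D : Set} → (D → Set) → Set
Finite {D} P = Σ (List D) λ l → ∀ d → P d → d ∈ l

-- Valuations V : A → ℘(D), subsets as predicates.
Val : ℕ → Set → Set₁
Val k D = Fin k → D → Set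

extend : ∀ {n} {D : Set} → (Fin n → D) → D → Fin (suc n) → D
extend g d zero = d
extend g d (suc i) = g i

Sat : ∀ {k n} (D : Set) → Val k D → (Fin n → D) → Fm k n → Set
Sat D V g tt = ⊤
Sat D V g ff = ⊥
Sat D V g (atom a x) = V a (g x)
Sat D V g (natom a x) = ¬ V a (g x)
Sat D V g (eq x y) = g x ≡ g y
Sat D V g (neq x y) = ¬ (g x ≡ g y)
Sat D V g (or φ ψ) = Sat D V g φ ⊎ Sat D V g ψ
Sat D V g (and φ ψ) = Sat D V g φ × Sat D V g ψ
Sat D V g (ex φ) = Σ D λ d → Sat D V (extend g d) φ
Sat D V g (all φ) = ∀ d → Sat D V (extend g d) φ
Sat D V g (exInf φ) = ¬ Finite (λ d → Sat D V (extend g d) φ)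
Sat D V g (allInf φ) = Σ (List D) λ l → ∀ d → d ∈ l ⊎ Sat D V (extend g d) φ

_≤[_]_ : ∀ {k} {D : Set} → Val k D → Subset k → Val k D → Set
U ≤[ B ] V = (∀ b → b ∈ₛ B → ∀ d → U b d → V b d)
           × (∀ a → a ∉ₛ B → ∀ d → U a d ⇔ V a d)

_≤ω[_]_ : ∀ {k} {D : Set} → Val k D → Subset k → Val k D → Set
U ≤ω[ B ] V = U ≤[ B ] V × (∀ b → b ∈ₛ B → Finite (U b))

Monotone : ∀ {k n} → Subset k → Fm k n → Set₁
Monotone {k} {n} B φ = ∀ (D : Set) (V V' : Val k D) (g : Fin n → D) →
  Sat D V g φ → V ≤[ B ] V' → Sat D V' g φ

Continuous : ∀ {k n} → Subset k → Fm k n → Set₁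
Continuous {k} {n} B φ = Monotone B φ ×
  (∀ (D : Set) (V : Val k D) (g : Fin n → D) → Sat D V g φ →
     Σ (Val k D) λ U → U ≤ω[ B ] V × Sat D U g φ)

module Submission where

-- A formula that does not mention B is insensitive to the interpretation of B, and every
-- constructor of a syntactically B-continuous formula needs only finitely many
-- B-facts: an atom b(x) needs the single fact about x, ∧ the union of the facts needed
-- by its conjuncts, ∨ and ∃ the facts of one disjunct or witness. For W x.(φ , ψ),
-- outside the finite exception set of ∀^∞x.ψ the B-free ψ holds regardless of B, so
-- only the finitely many exceptions need witnesses for φ ∨ ψ. Hence restricting every
-- b ∈ B to a suitable finite list of elements preserves truth.

open import Defs
open import Data.Nat using (ℕ)
open import Data.Fin using (Fin)
open import Data.Fin.Subset using (Subset) renaming (_∈_ to _∈ₛ_; _∉_ to _∉ₛ_)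
open import Data.List using (List; []; _∷_; _++_)
open import Data.List.Membership.Propositional using (_∈_)
open import Data.List.Relation.Binary.Subset.Propositional using (_⊆_)
open import Data.List.Relation.Binary.Subset.Propositional.Properties
  using (xs⊆xs++ys; xs⊆ys++xs)
open import Data.List.Relation.Unary.Any using (here; there)
open import Data.Product using (Σ; _×_; _,_; proj₁; proj₂)
open import Data.Sum using (inj₁; inj₂; [_,_]′)
open import Data.Empty using (⊥-elim)
open import Relation.Binary.PropositionalEquality using (refl)
open import Function using (_∘_)
open import Function.Bundles using (_⇔_; mk⇔; Equivalence)

AgreeOutside : ∀ {k} {D : Set} → Subset k → Val k D → Val k D → Set
AgreeOutside B V V' = ∀ a → a ∉ₛ B → ∀ d → V a d ⇔ V' a d

module _ {k : ℕ} {B : Subset k} {D : Set} {V V' : Val k D}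
         (V≈V' : AgreeOutside B V V') where

  sat-free-invariant : ∀ {n} {ψ : Fm k n} → Free B ψ →
                       ∀ (g : Fin n → D) → Sat D V g ψ → Sat D V' g ψ
  sat-free-invariant tt g s = s
  sat-free-invariant (atom a x a∉B) g s = Equivalence.to (V≈V' a a∉B (g x)) s
  sat-free-invariant (natom a x a∉B) g s = s ∘ Equivalence.from (V≈V' a a∉B (g x))
  sat-free-invariant (eq x y) g s = s
  sat-free-invariant (neq x y) g s = s
  sat-free-invariant (or f f') g (inj₁ s) = inj₁ (sat-free-invariant f g s)
  sat-free-invariant (or f f') g (inj₂ s) = inj₂ (sat-free-invariant f' g s)
  sat-free-invariant (and f f') g (s , s') =
    sat-free-invariant f g s , sat-free-invariant f' g s'
  sat-free-invariant (ex f) g (d , s) = d , sat-free-invariant f (extend g d) s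
  sat-free-invariant (all f) g s d = sat-free-invariant f (extend g d) (s d)
  sat-free-invariant (exInf f) g s (l , fin) =
    s (l , λ d → fin d ∘ sat-free-invariant f (extend g d))
  sat-free-invariant (allInf f) g (l , cofin) =
    l , λ d → Data.Sum.map₂ (sat-free-invariant f (extend g d)) (cofin d)

SynCont-monotone : ∀ {L k n} {B : Subset k} {φ : Fm k n} → SynCont L B φ → Monotone B φ
SynCont-monotone (base _ f) D V V' g s V≤V' = sat-free-invariant (proj₂ V≤V') f g s
SynCont-monotone (atomB b x b∈B) D V V' g s V≤V' = proj₁ V≤V' b b∈B (g x) s
SynCont-monotone (and c c') D V V' g (s , s') V≤V' =
  SynCont-monotone c D V V' g s V≤V' , SynCont-monotone c' D V V' g s' V≤V'
SynCont-monotone (or c c') D V V' g (inj₁ s) V≤V' = inj₁ (SynCont-monotone c D V V' g s V≤V')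
SynCont-monotone (or c c') D V V' g (inj₂ s) V≤V' = inj₂ (SynCont-monotone c' D V V' g s V≤V')
SynCont-monotone (ex c) D V V' g (d , s) V≤V' = d , SynCont-monotone c D V V' (extend g d) s V≤V'
SynCont-monotone (W' _ c ψ∈L f) D V V' g (s , (l , cofin)) V≤V' =
  (λ d → SynCont-monotone (or c (base ψ∈L f)) D V V' (extend g d) (s d) V≤V')
  , (l , λ d → Data.Sum.map₂ (sat-free-invariant (proj₂ V≤V') f (extend g d)) (cofin d))

restrict : ∀ {k} {D : Set} → Subset k → List D → Val k D → Val k D
restrict B l V a d = V a d × (a ∈ₛ B → d ∈ l)

module _ {k : ℕ} (B : Subset k) {D : Set} (V : Val k D) where

  restrict-agreeOutside : ∀ l → AgreeOutside B V (restrict B l V)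
  restrict-agreeOutside l a a∉B d = mk⇔ (λ v → v , ⊥-elim ∘ a∉B) proj₁

  restrict-≤ω : ∀ l → restrict B l V ≤ω[ B ] V
  restrict-≤ω l = ((λ b _ d → proj₁) , (λ a a∉B d → mk⇔ proj₁ (λ v → v , ⊥-elim ∘ a∉B)))
                , (λ b b∈B → l , λ d v → proj₂ v b∈B)

  restrict-mono : ∀ {l l'} → l ⊆ l' → restrict B l V ≤[ B ] restrict B l' V
  restrict-mono l⊆l' =
    (λ b _ d → Data.Product.map₂ (l⊆l' ∘_))
    , (λ a a∉B d → mk⇔ (Data.Product.map₂ (l⊆l' ∘_)) (λ v → proj₁ v , ⊥-elim ∘ a∉B))

merge-witnesses : {D : Set} (P : List D → D → Set) →
                  (∀ {l l' d} → l ⊆ l' → P l d → P l' d) →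
                  (xs : List D) → (∀ d → d ∈ xs → Σ (List D) λ l → P l d) →
                  Σ (List D) λ l → ∀ d → d ∈ xs → P l d
merge-witnesses P P-mono [] wit = [] , λ d ()
merge-witnesses P P-mono (x ∷ xs) wit
  with wit x (here refl) | merge-witnesses P P-mono xs (λ d → wit d ∘ there)
... | lx , px | lxs , pxs = lx ++ lxs , merged
  where
  merged : ∀ d → d ∈ x ∷ xs → P (lx ++ lxs) d
  merged d (here refl) = P-mono (xs⊆xs++ys lx lxs) px
  merged d (there d∈xs) = P-mono (xs⊆ys++xs lxs lx) (pxs d d∈xs)

SynCont-finite-support : ∀ {L k n} {B : Subset k} {φ : Fm k n} → SynCont L B φ →
  ∀ (D : Set) (V : Val k D) (g : Fin n → D) → Sat D V g φ →
  Σ (List D) λ l → Sat D (restrict B l V) g φ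
SynCont-finite-support {B = B} (base _ f) D V g s =
  [] , sat-free-invariant (restrict-agreeOutside B V []) f g s
SynCont-finite-support (atomB b x b∈B) D V g s = g x ∷ [] , (s , λ _ → here refl)
SynCont-finite-support {B = B} (and c c') D V g (s , s')
  with SynCont-finite-support c D V g s | SynCont-finite-support c' D V g s'
... | l , t | l' , t' =
  l ++ l' , ( SynCont-monotone c D _ _ g t (restrict-mono B V (xs⊆xs++ys l l'))
            , SynCont-monotone c' D _ _ g t' (restrict-mono B V (xs⊆ys++xs l' l)))
SynCont-finite-support (or c c') D V g (inj₁ s) =
  Data.Product.map₂ inj₁ (SynCont-finite-support c D V g s)
SynCont-finite-support (or c c') D V g (inj₂ s) =
  Data.Product.map₂ inj₂ (SynCont-finite-support c' D V g s)
SynCont-finite-support (ex c) D V g (d , s) =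
  Data.Product.map₂ (d ,_) (SynCont-finite-support c D V (extend g d) s)
SynCont-finite-support {B = B} (W' {φ = φ} {ψ} _ c ψ∈L f) D V g (s , (exceptions , cofin)) =
  l , ((λ d → [ holds-on-exceptions d , inj₂ ∘ ψ-restricted l d ]′ (cofin d))
      , (exceptions , λ d → Data.Sum.map₂ (ψ-restricted l d) (cofin d)))
  where
  c∨ : SynCont _ B (or φ ψ)
  c∨ = or c (base ψ∈L f)

  Witnessed : List D → D → Set
  Witnessed l d = Sat D (restrict B l V) (extend g d) (or φ ψ)

  ψ-restricted : ∀ l d → Sat D V (extend g d) ψ → Sat D (restrict B l V) (extend g d) ψ
  ψ-restricted l d = sat-free-invariant (restrict-agreeOutside B V l) f (extend g d)

  witness : ∀ d → Sat D V (extend g d) (or φ ψ) → Σ (List D) λ l → Witnessed l d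
  witness d (inj₁ sφ) = Data.Product.map₂ inj₁ (SynCont-finite-support c D V (extend g d) sφ)
  witness d (inj₂ sψ) = [] , inj₂ (ψ-restricted [] d sψ)

  merged : Σ (List D) λ l → ∀ d → d ∈ exceptions → Witnessed l d
  merged = merge-witnesses Witnessed
    (λ {_} {_} {d} l⊆l' w → SynCont-monotone c∨ D _ _ (extend g d) w (restrict-mono B V l⊆l'))
    exceptions (λ d _ → witness d (s d))

  l : List D
  l = proj₁ merged

  holds-on-exceptions : ∀ d → d ∈ exceptions → Witnessed l d
  holds-on-exceptions = proj₂ merged

proposition5p7 : (L : Lang) {k : ℕ} (B : Subset k) (φ : Fm k 0) →
    SynCont L B φ → Continuous B φ
proposition5p7 L B φ c = SynCont-monotone c , λ D V g s →
  let (l , t) = SynCont-finite-support c D V g s in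
  restrict B l V , restrict-≤ω B V l , t
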